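{- Let $T$ be a tree and $v,w,u$ a path in $T$ with $deg(v)=1$ and $deg(w)=2$. Then $|E_{fix}(T)|\le |E_{fix}(T_v)|+|E_{fix}(T_w)|$, where $T_v=T\setminus v$ and $T_w=T_v\setminus w$.
   Context: For a tree $T=(V,E)$, $E_{fix}(T)$ is the set of all $F\subseteq E$ with $2deg_F(x)\le deg(x)$ for every $x\in V$, where $deg_F(x)$ is the number of edges of $F$ incident to $x$ and $deg(x)$ is the degree of $x$ in $T$. $T\setminus v$ denotes the tree obtained by deleting the leaf $v$ and its incident edge. -}

module Defs where

open import Data.Nat using (ℕ; zero; suc; _*_; _≤_; _≤?_)
open import Data.Bool using (Bool; true; false)
open import Data.Fin using (Fin)
open import Data.Fin.Properties using (_≟_; all?)
open import Data.Product using (_×_; _,_; proj₁; proj₂; Σ; ∃)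
open import Data.Sum using (_⊎_)
open import Data.List using (List; []; _∷_; [_]; _++_; map; filter; length)
open import Data.List.Membership.Propositional using (_∈_)
open import Data.List.Relation.Unary.All using (All)
open import Data.List.Relation.Unary.AllPairs using (AllPairs)
open import Data.List.Relation.Unary.Linked using (Linked)
open import Data.List.Relation.Unary.Unique.Propositional using (Unique)
open import Data.Vec using (Vec)
import Data.Vec as Vec
open import Relation.Nullary using (¬_; Dec; ¬?)
open import Relation.Nullary.Decidable using (_⊎-dec_)
open import Relation.Binary.PropositionalEquality using (_≡_; _≢_)

-- A graph on vertex set Fin n is given by its list of edges;
-- an edge is a pair of endpoints (orientation irrelevant).
Edge : ℕ → Set
Edge n = Fin n × Fin n

Incident : ∀ {n} → Fin n → Edge n → Set
Incident x e = proj₁ e ≡ x ⊎ proj₂ e ≡ x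

incident? : ∀ {n} (x : Fin n) (e : Edge n) → Dec (Incident x e)
incident? x e = (proj₁ e ≟ x) ⊎-dec (proj₂ e ≟ x)

deg : ∀ {n} → List (Edge n) → Fin n → ℕ
deg E x = length (filter (incident? x) E)

Adj : ∀ {n} → List (Edge n) → Fin n → Fin n → Set
Adj E x y = (x , y) ∈ E ⊎ (y , x) ∈ E

SameEdge : ∀ {n} → Edge n → Edge n → Set
SameEdge (a , b) (c , d) = (a ≡ c × b ≡ d) ⊎ (a ≡ d × b ≡ c)

data Reach {n} (E : List (Edge n)) (x : Fin n) : Fin n → Set where
  here : Reach E x x
  step : ∀ {y z} → Reach E x y → Adj E y z → Reach E x z

Cycle : ∀ {n} → List (Edge n) → Set
Cycle {n} E = Σ (Fin n) λ x → Σ (List (Fin n)) λ ys →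
  (2 ≤ length ys) × Unique (x ∷ ys) × Linked (Adj E) (x ∷ ys ++ [ x ])

record IsTree {n} (E : List (Edge n)) : Set where
  field
    noLoops   : All (λ e → proj₁ e ≢ proj₂ e) E
    noMulti   : AllPairs (λ e f → ¬ SameEdge e f) E
    connected : ∀ x y → Reach E x y
    acyclic   : ¬ Cycle E

-- subsets of the edge list E, as selection masks
allMasks : (k : ℕ) → List (Vec Bool k)
allMasks zero = Vec.[] ∷ []
allMasks (suc k) = map (true Vec.∷_) (allMasks k) ++ map (false Vec.∷_) (allMasks k)

select : ∀ {A : Set} (E : List A) → Vec Bool (length E) → List A
select [] Vec.[] = []
select (e ∷ E) (true Vec.∷ m) = e ∷ select E m
select (e ∷ E) (false Vec.∷ m) = select E m

IsFix : ∀ {n} → List (Edge n) → List (Edge n) → Set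
IsFix E F = ∀ x → 2 * deg F x ≤ deg E x

isFix? : ∀ {n} (E F : List (Edge n)) → Dec (IsFix E F)
isFix? E F = all? (λ x → 2 * deg F x ≤? deg E x)

efixCount : ∀ {n} → List (Edge n) → ℕ
efixCount E = length (filter (λ m → isFix? E (select E m)) (allMasks (length E)))

-- T \ v : delete vertex v and its incident edges
-- (v stays in the vertex set as an isolated vertex; it has degree 0 in both
--  the graph and any edge subset, so E_fix is unaffected)
deleteVertex : ∀ {n} → Fin n → List (Edge n) → List (Edge n)
deleteVertex v E = filter (λ e → ¬? (incident? v e)) E

{-# OPTIONS --safe #-}
-- Up to reordering, the edge list is a ∷ b ∷ R with a = vw and b = wu, and by the degree
-- conditions v and w touch no edge of R, so T_v = b ∷ R and T_w = R. No F ∈ E_fix(T) contains a,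
-- as v is a leaf. If F = b ∷ S then S ∈ E_fix(T_w): removing b from both F and T keeps
-- 2 deg_F ≤ deg, and removing a from T changes no degree that S sees. If F = S ⊆ R then
-- likewise S ∈ E_fix(T_v). Both maps F ↦ S are injective, which gives the bound.
module Submission where

open import Defs
open import Data.Nat using (ℕ; suc; _+_; _*_; _≤_; z≤n; s≤s; s≤s⁻¹)
open import Data.Nat.Properties
  using (≤-trans; ≤-antisym; m≤n⇒m≤1+n; m≤n+m; n≤1+n; +-comm; +-mono-≤; +-monoʳ-≤;
         *-monoʳ-≤; <⇒≢; suc-injective; +-commutativeSemigroup; module ≤-Reasoning)
open import Data.Bool using (Bool; true; false)
open import Data.Fin using (Fin)
open import Data.List using (List; []; _∷_; _++_; map; filter; length)
open import Data.List.Properties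
  using (length-++; filter-++; filter-all; filter-accept; filter-reject; filter-none; filter-some)
open import Data.List.Membership.Propositional using (_∈_)
open import Data.List.Membership.Propositional.Properties using (∈-∃++)
open import Data.List.Relation.Unary.Any using (here; there)
open import Data.List.Relation.Unary.All using (All; []; _∷_; tabulate) renaming (tail to All-tail)
open import Data.List.Relation.Unary.All.Properties using (¬Any⇒All¬)
open import Data.List.Relation.Binary.Permutation.Propositional
  using (_↭_; ↭-refl; ↭-reflexive; ↭-sym; ↭-prep; ↭-swap; ↭-trans; ↭⇒↭ₛ; ↭ₛ⇒↭)
open import Data.List.Relation.Binary.Permutation.Propositional.Properties using (shift; ∈-resp-↭; ↭-length)
import Data.List.Relation.Binary.Permutation.Setoid.Properties as ↭ₛ
open import Data.Product using (_×_; _,_; ∃)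
open import Data.Sum using (_⊎_; inj₁; inj₂)
open import Data.Vec using (Vec)
import Data.Vec as Vec
open import Function using (_∘_; id)
open import Relation.Nullary using (¬_; ¬?; yes; no; contradiction)
open import Relation.Unary using (Decidable)
open import Relation.Binary.Definitions using (_Respects_)
open import Relation.Binary.PropositionalEquality
  using (_≡_; _≢_; refl; sym; trans; cong; cong₂; subst; subst₂; setoid; module ≡-Reasoning)
open import Algebra.Properties.CommutativeSemigroup +-commutativeSemigroup using (interchange)

module _ {A : Set} where

  filter-↭ : {P : A → Set} (P? : Decidable P) {xs ys : List A} → xs ↭ ys →
    filter P? xs ↭ filter P? ys
  filter-↭ P? p = ↭ₛ⇒↭ (↭ₛ.filter⁺ (setoid A) P? (λ { refl → id }) (↭⇒↭ₛ p))

  ∈⇒↭∷ : {x : A} {xs : List A} → x ∈ xs → ∃ λ ys → xs ↭ x ∷ ys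
  ∈⇒↭∷ {x} x∈xs with ys , zs , refl ← ∈-∃++ x∈xs = ys ++ zs , shift x ys zs

  ∈∧∈⇒↭∷∷ : {x y : A} {xs : List A} → x ∈ xs → y ∈ xs → x ≢ y → ∃ λ ys → xs ↭ x ∷ y ∷ ys
  ∈∧∈⇒↭∷∷ x∈xs y∈xs x≢y with ys , xs↭x∷ys ← ∈⇒↭∷ x∈xs with ∈-resp-↭ xs↭x∷ys y∈xs
  ... | here y≡x = contradiction (sym y≡x) x≢y
  ... | there y∈ys with zs , ys↭y∷zs ← ∈⇒↭∷ y∈ys =
    zs , ↭-trans xs↭x∷ys (↭-prep _ ys↭y∷zs)

  length-filter-map : {B : Set} {P : A → Set} (P? : Decidable P) (f : B → A) (xs : List B) →
    length (filter P? (map f xs)) ≡ length (filter (P? ∘ f) xs)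
  length-filter-map P? f [] = refl
  length-filter-map P? f (x ∷ xs) with P? (f x)
  ... | yes _ = cong suc (length-filter-map P? f xs)
  ... | no _ = length-filter-map P? f xs

  length-filter-mono : {P Q : A → Set} (P? : Decidable P) (Q? : Decidable Q) →
    (∀ x → P x → Q x) → (xs : List A) → length (filter P? xs) ≤ length (filter Q? xs)
  length-filter-mono P? Q? P⇒Q [] = z≤n
  length-filter-mono P? Q? P⇒Q (x ∷ xs) with P? x | Q? x
  ... | yes _ | yes _ = s≤s (length-filter-mono P? Q? P⇒Q xs)
  ... | yes p | no ¬q = contradiction (P⇒Q x p) ¬q
  ... | no _ | yes _ = m≤n⇒m≤1+n (length-filter-mono P? Q? P⇒Q xs)
  ... | no _ | no _ = length-filter-mono P? Q? P⇒Q xs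

module _ {A : Set} where

  All-select : {P : A → Set} (xs : List A) (m : Vec Bool (length xs)) → All P xs → All P (select xs m)
  All-select [] Vec.[] [] = []
  All-select (x ∷ xs) (true Vec.∷ m) (px ∷ pxs) = px ∷ All-select xs m pxs
  All-select (x ∷ xs) (false Vec.∷ m) (px ∷ pxs) = All-select xs m pxs

  -- efixCount E is definitionally countSublists E (isFix? E).
  countSublists : (xs : List A) {P : List A → Set} → Decidable P → ℕ
  countSublists xs P? = length (filter (P? ∘ select xs) (allMasks (length xs)))

  countSublists-∷ : (x : A) (xs : List A) {P : List A → Set} (P? : Decidable P) →
    countSublists (x ∷ xs) P? ≡ countSublists xs (P? ∘ (x ∷_)) + countSublists xs P?
  countSublists-∷ x xs {P} P? = begin
      length (filter Q? (map (true Vec.∷_) ms ++ map (false Vec.∷_) ms))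
    ≡⟨ cong length (filter-++ Q? (map (true Vec.∷_) ms) _) ⟩
      length (filter Q? (map (true Vec.∷_) ms) ++ filter Q? (map (false Vec.∷_) ms))
    ≡⟨ length-++ (filter Q? (map (true Vec.∷_) ms)) ⟩
      length (filter Q? (map (true Vec.∷_) ms)) + length (filter Q? (map (false Vec.∷_) ms))
    ≡⟨ cong₂ _+_ (length-filter-map Q? (true Vec.∷_) ms) (length-filter-map Q? (false Vec.∷_) ms) ⟩
      countSublists xs (P? ∘ (x ∷_)) + countSublists xs P?
    ∎
    where
    open ≡-Reasoning
    ms : List (Vec Bool (length xs))
    ms = allMasks (length xs)
    Q? : Decidable (P ∘ select (x ∷ xs))
    Q? = P? ∘ select (x ∷ xs)

  countSublists-∷∷ : (x y : A) (xs : List A) {P : List A → Set} (P? : Decidable P) →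
    countSublists (x ∷ y ∷ xs) P? ≡
      (countSublists xs (P? ∘ (x ∷_) ∘ (y ∷_)) + countSublists xs (P? ∘ (x ∷_)))
      + (countSublists xs (P? ∘ (y ∷_)) + countSublists xs P?)
  countSublists-∷∷ x y xs P? =
    trans (countSublists-∷ x (y ∷ xs) P?)
      (cong₂ _+_ (countSublists-∷ y xs (P? ∘ (x ∷_))) (countSublists-∷ y xs P?))

  countSublists-mono : (xs : List A) {P Q : List A → Set} (P? : Decidable P) (Q? : Decidable Q) →
    (∀ m → P (select xs m) → Q (select xs m)) → countSublists xs P? ≤ countSublists xs Q?
  countSublists-mono xs P? Q? P⇒Q =
    length-filter-mono (P? ∘ select xs) (Q? ∘ select xs) P⇒Q (allMasks (length xs))

  countSublists-cong : (xs : List A) {P Q : List A → Set} (P? : Decidable P) (Q? : Decidable Q) →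
    (∀ ys → P ys → Q ys) → (∀ ys → Q ys → P ys) → countSublists xs P? ≡ countSublists xs Q?
  countSublists-cong xs P? Q? P⇒Q Q⇒P =
    ≤-antisym (countSublists-mono xs P? Q? (P⇒Q ∘ select xs))
              (countSublists-mono xs Q? P? (Q⇒P ∘ select xs))

  countSublists-≡0 : (xs : List A) {P : List A → Set} (P? : Decidable P) → (∀ ys → ¬ P ys) →
    countSublists xs P? ≡ 0
  countSublists-≡0 xs P? ¬P =
    cong length (filter-none (P? ∘ select xs) {allMasks (length xs)}
                             (tabulate λ {m} _ → ¬P (select xs m)))

  countSublists-≤-∷ : (x : A) (xs : List A) {P : List A → Set} (P? : Decidable P) →
    countSublists xs P? ≤ countSublists (x ∷ xs) P?
  countSublists-≤-∷ x xs P? = subst (countSublists xs P? ≤_) (sym (countSublists-∷ x xs P?)) (m≤n+m _ _)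

  countSublists-↭ : {xs ys : List A} {P : List A → Set} (P? : Decidable P) →
    P Respects _↭_ → xs ↭ ys → countSublists xs P? ≡ countSublists ys P?
  countSublists-↭ P? resp (_↭_.refl) = refl
  countSublists-↭ {x ∷ xs} {_ ∷ ys} P? resp (_↭_.prep _ p) =
    trans (countSublists-∷ x xs P?)
      (trans (cong₂ _+_ (countSublists-↭ (P? ∘ (x ∷_)) (resp ∘ ↭-prep x) p)
                        (countSublists-↭ P? resp p))
        (sym (countSublists-∷ x ys P?)))
  countSublists-↭ {x ∷ y ∷ xs} {_ ∷ _ ∷ ys} P? resp (_↭_.swap _ _ p) = begin
      countSublists (x ∷ y ∷ xs) P?
    ≡⟨ countSublists-∷∷ x y xs P? ⟩
      (# xs (P? ∘ (x ∷_) ∘ (y ∷_)) + # xs (P? ∘ (x ∷_))) + (# xs (P? ∘ (y ∷_)) + # xs P?)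
    ≡⟨ interchange (# xs (P? ∘ (x ∷_) ∘ (y ∷_))) (# xs (P? ∘ (x ∷_))) (# xs (P? ∘ (y ∷_))) (# xs P?) ⟩
      (# xs (P? ∘ (x ∷_) ∘ (y ∷_)) + # xs (P? ∘ (y ∷_))) + (# xs (P? ∘ (x ∷_)) + # xs P?)
    ≡⟨ cong₂ _+_ (cong₂ _+_ both-first (ih (P? ∘ (y ∷_)) (resp ∘ ↭-prep y)))
                 (cong₂ _+_ (ih (P? ∘ (x ∷_)) (resp ∘ ↭-prep x)) (ih P? resp)) ⟩
      (# ys (P? ∘ (y ∷_) ∘ (x ∷_)) + # ys (P? ∘ (y ∷_))) + (# ys (P? ∘ (x ∷_)) + # ys P?)
    ≡⟨ sym (countSublists-∷∷ y x ys P?) ⟩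
      countSublists (y ∷ x ∷ ys) P?
    ∎
    where
    open ≡-Reasoning
    # : (zs : List A) {Q : List A → Set} → Decidable Q → ℕ
    # = countSublists
    ih : {Q : List A → Set} (Q? : Decidable Q) → Q Respects _↭_ → # xs Q? ≡ # ys Q?
    ih Q? Q-resp = countSublists-↭ Q? Q-resp p
    both-first : # xs (P? ∘ (x ∷_) ∘ (y ∷_)) ≡ # ys (P? ∘ (y ∷_) ∘ (x ∷_))
    both-first = trans (ih (P? ∘ (x ∷_) ∘ (y ∷_)) (resp ∘ ↭-prep x ∘ ↭-prep y))
      (countSublists-cong ys (P? ∘ (x ∷_) ∘ (y ∷_)) (P? ∘ (y ∷_) ∘ (x ∷_))
        (λ _ → resp (↭-swap x y ↭-refl)) (λ _ → resp (↭-swap y x ↭-refl)))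
  countSublists-↭ P? resp (_↭_.trans p q) =
    trans (countSublists-↭ P? resp p) (countSublists-↭ P? resp q)

2*1+m≤1+n⇒2*m≤n : ∀ {m n} → 2 * suc m ≤ suc n → 2 * m ≤ n
2*1+m≤1+n⇒2*m≤n {m} h = ≤-trans (+-monoʳ-≤ m (n≤1+n _)) (s≤s⁻¹ h)

2*1+m≰1 : ∀ {m} → ¬ 2 * suc m ≤ 1
2*1+m≰1 h with ≤-trans (*-monoʳ-≤ 2 (s≤s z≤n)) h
... | s≤s ()

double≤-resp-≡ : ∀ {d d′ r r′} → d ≡ d′ → r ≡ r′ → 2 * d ≤ r → 2 * d′ ≤ r′
double≤-resp-≡ = subst₂ (λ d r → 2 * d ≤ r)

module _ {n : ℕ} where

  deg-∷-incident : {x : Fin n} {e : Edge n} (L : List (Edge n)) → Incident x e →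
    deg (e ∷ L) x ≡ suc (deg L x)
  deg-∷-incident {x} L i = cong length (filter-accept (incident? x) i)

  deg-∷-nonincident : {x : Fin n} {e : Edge n} (L : List (Edge n)) → ¬ Incident x e →
    deg (e ∷ L) x ≡ deg L x
  deg-∷-nonincident {x} L ¬i = cong length (filter-reject (incident? x) ¬i)

  deg-↭ : (x : Fin n) {L L′ : List (Edge n)} → L ↭ L′ → deg L x ≡ deg L′ x
  deg-↭ x p = ↭-length (filter-↭ (incident? x) p)

  deg≡0⇒untouched : (x : Fin n) (L : List (Edge n)) → deg L x ≡ 0 → All (¬_ ∘ Incident x) L
  deg≡0⇒untouched x L d≡0 = ¬Any⇒All¬ L (λ i → <⇒≢ (filter-some (incident? x) i) (sym d≡0))

  untouched⇒deg≡0 : (x : Fin n) {L : List (Edge n)} → All (¬_ ∘ Incident x) L → deg L x ≡ 0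
  untouched⇒deg≡0 x u = cong length (filter-none (incident? x) u)

  deleteVertex-↭ : (x : Fin n) {E E′ : List (Edge n)} → E ↭ E′ →
    deleteVertex x E ↭ deleteVertex x E′
  deleteVertex-↭ x = filter-↭ (¬? ∘ incident? x)

  deleteVertex-∷-incident : {x : Fin n} {e : Edge n} (E : List (Edge n)) → Incident x e →
    deleteVertex x (e ∷ E) ≡ deleteVertex x E
  deleteVertex-∷-incident {x} E i = filter-reject (¬? ∘ incident? x) (λ ¬i → ¬i i)

  deleteVertex-untouched : (x : Fin n) {E : List (Edge n)} → All (¬_ ∘ Incident x) E →
    deleteVertex x E ≡ E
  deleteVertex-untouched x = filter-all (¬? ∘ incident? x)

  IsFix-↭ : {E E′ F F′ : List (Edge n)} → E ↭ E′ → F ↭ F′ → IsFix E F → IsFix E′ F′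
  IsFix-↭ E↭E′ F↭F′ fix x = double≤-resp-≡ (deg-↭ x F↭F′) (deg-↭ x E↭E′) (fix x)

  IsFix-∷⁻ : (e : Edge n) {E F : List (Edge n)} → IsFix (e ∷ E) (e ∷ F) → IsFix E F
  IsFix-∷⁻ e {E} {F} fix x with incident? x e
  ... | yes i =
    2*1+m≤1+n⇒2*m≤n (double≤-resp-≡ (deg-∷-incident F i) (deg-∷-incident E i) (fix x))
  ... | no ¬i = double≤-resp-≡ (deg-∷-nonincident F ¬i) (deg-∷-nonincident E ¬i) (fix x)

  IsFix-untouched-∷⁻ : {e : Edge n} {E F : List (Edge n)} → (∀ x → Incident x e → deg F x ≡ 0) →
    IsFix (e ∷ E) F → IsFix E F
  IsFix-untouched-∷⁻ {e} {E} {F} untouched fix x with incident? x e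
  ... | yes i = subst (λ d → 2 * d ≤ deg E x) (sym (untouched x i)) z≤n
  ... | no ¬i = subst (2 * deg F x ≤_) (deg-∷-nonincident E ¬i) (fix x)

  ¬IsFix-leaf : {v : Fin n} {e : Edge n} {E F : List (Edge n)} → Incident v e → deg E v ≡ 1 →
    ¬ IsFix E (e ∷ F)
  ¬IsFix-leaf {v} {F = F} i dv fix = 2*1+m≰1 (double≤-resp-≡ (deg-∷-incident F i) dv (fix v))

  efixCount-↭ : {E E′ : List (Edge n)} → E ↭ E′ → efixCount E ≡ efixCount E′
  efixCount-↭ {E} {E′} p = trans (countSublists-↭ (isFix? E) (IsFix-↭ {E} ↭-refl) p)
    (countSublists-cong E′ (isFix? E) (isFix? E′)
      (λ F → IsFix-↭ {F = F} p ↭-refl) (λ F → IsFix-↭ {F = F} (↭-sym p) ↭-refl))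

  Joins : Edge n → Fin n → Fin n → Set
  Joins e p q = e ≡ (p , q) ⊎ e ≡ (q , p)

  Adj⇒Joins : {E : List (Edge n)} {p q : Fin n} → Adj E p q → ∃ λ e → e ∈ E × Joins e p q
  Adj⇒Joins (inj₁ pq∈E) = _ , pq∈E , inj₁ refl
  Adj⇒Joins (inj₂ qp∈E) = _ , qp∈E , inj₂ refl

  Joins-incidentˡ : {e : Edge n} {p q : Fin n} → Joins e p q → Incident p e
  Joins-incidentˡ (inj₁ refl) = inj₁ refl
  Joins-incidentˡ (inj₂ refl) = inj₂ refl

  Joins-incidentʳ : {e : Edge n} {p q : Fin n} → Joins e p q → Incident q e
  Joins-incidentʳ (inj₁ refl) = inj₂ refl
  Joins-incidentʳ (inj₂ refl) = inj₁ refl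

  Joins-endpoints : {e : Edge n} {p q x : Fin n} → Joins e p q → Incident x e → x ≡ p ⊎ x ≡ q
  Joins-endpoints (inj₁ refl) (inj₁ refl) = inj₁ refl
  Joins-endpoints (inj₁ refl) (inj₂ refl) = inj₂ refl
  Joins-endpoints (inj₂ refl) (inj₁ refl) = inj₂ refl
  Joins-endpoints (inj₂ refl) (inj₂ refl) = inj₁ refl

  Joins-path-≢ : {a b : Edge n} {v w u : Fin n} → v ≢ u → Joins a v w → Joins b w u → a ≢ b
  Joins-path-≢ v≢u (inj₁ refl) (inj₁ refl) refl = v≢u refl
  Joins-path-≢ v≢u (inj₁ refl) (inj₂ refl) refl = v≢u refl
  Joins-path-≢ v≢u (inj₂ refl) (inj₁ refl) refl = v≢u refl
  Joins-path-≢ v≢u (inj₂ refl) (inj₂ refl) refl = v≢u refl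

  efixCount-path-≤ : {v w : Fin n} (a b : Edge n) (R : List (Edge n)) → Joins a v w →
    All (¬_ ∘ Incident v) (b ∷ R) → All (¬_ ∘ Incident w) R →
    efixCount (a ∷ b ∷ R) ≤ efixCount (b ∷ R) + efixCount R
  efixCount-path-≤ {v} {w} a b R ja v∉bR w∉R = begin
      efixCount E
    ≡⟨ countSublists-∷ a (b ∷ R) (isFix? E) ⟩
      countSublists (b ∷ R) (isFix? E ∘ (a ∷_)) + countSublists (b ∷ R) (isFix? E)
    ≡⟨ cong (_+ countSublists (b ∷ R) (isFix? E))
            (countSublists-≡0 (b ∷ R) (isFix? E ∘ (a ∷_)) (λ S → ¬IsFix-leaf {E = E} {F = S} va dv)) ⟩
      countSublists (b ∷ R) (isFix? E)
    ≡⟨ countSublists-∷ b R (isFix? E) ⟩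
      countSublists R (isFix? E ∘ (b ∷_)) + countSublists R (isFix? E)
    ≤⟨ +-mono-≤ (countSublists-mono R (isFix? E ∘ (b ∷_)) (isFix? R) containing-b)
                (≤-trans (countSublists-mono R (isFix? E) (isFix? (b ∷ R)) avoiding-b)
                         (countSublists-≤-∷ b R (isFix? (b ∷ R)))) ⟩
      efixCount R + efixCount (b ∷ R)
    ≡⟨ +-comm (efixCount R) (efixCount (b ∷ R)) ⟩
      efixCount (b ∷ R) + efixCount R
    ∎
    where
    open ≤-Reasoning
    E : List (Edge n)
    E = a ∷ b ∷ R
    va : Incident v a
    va = Joins-incidentˡ ja
    dv : deg E v ≡ 1
    dv = trans (deg-∷-incident (b ∷ R) va) (cong suc (untouched⇒deg≡0 v v∉bR))
    v∉R : All (¬_ ∘ Incident v) R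
    v∉R = All-tail v∉bR
    a-untouched : ∀ m x → Incident x a → deg (select R m) x ≡ 0
    a-untouched m x xa with Joins-endpoints ja xa
    ... | inj₁ refl = untouched⇒deg≡0 v (All-select R m v∉R)
    ... | inj₂ refl = untouched⇒deg≡0 w (All-select R m w∉R)
    containing-b : ∀ m → IsFix E (b ∷ select R m) → IsFix R (select R m)
    containing-b m = IsFix-untouched-∷⁻ {E = R} {F = select R m} (a-untouched m) ∘ IsFix-∷⁻ b
                   ∘ IsFix-↭ {F = b ∷ select R m} (↭-swap a b ↭-refl) ↭-refl
    avoiding-b : ∀ m → IsFix E (select R m) → IsFix (b ∷ R) (select R m)
    avoiding-b m = IsFix-untouched-∷⁻ {E = b ∷ R} {F = select R m} (a-untouched m)

  efixCount-pendant-≤ : {E R : List (Edge n)} {a b : Edge n} {v w u : Fin n} → E ↭ a ∷ b ∷ R →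
    Joins a v w → Joins b w u → deg E v ≡ 1 → deg E w ≡ 2 →
    efixCount E ≤ efixCount (deleteVertex v E) + efixCount (deleteVertex w (deleteVertex v E))
  efixCount-pendant-≤ {E} {R} {a} {b} {v} {w} E↭abR ja jb dv dw = begin
      efixCount E
    ≡⟨ efixCount-↭ E↭abR ⟩
      efixCount (a ∷ b ∷ R)
    ≤⟨ efixCount-path-≤ a b R ja v∉bR w∉R ⟩
      efixCount (b ∷ R) + efixCount R
    ≡⟨ sym (cong₂ _+_ (efixCount-↭ Tv↭bR) (efixCount-↭ Tw↭R)) ⟩
      efixCount (deleteVertex v E) + efixCount (deleteVertex w (deleteVertex v E))
    ∎
    where
    open ≤-Reasoning
    v∉bR : All (¬_ ∘ Incident v) (b ∷ R)
    v∉bR = deg≡0⇒untouched v (b ∷ R) (suc-injective (begin-equality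
      suc (deg (b ∷ R) v)  ≡⟨ deg-∷-incident (b ∷ R) (Joins-incidentˡ ja) ⟨
      deg (a ∷ b ∷ R) v    ≡⟨ deg-↭ v E↭abR ⟨
      deg E v              ≡⟨ dv ⟩
      1                    ∎))
    w∉R : All (¬_ ∘ Incident w) R
    w∉R = deg≡0⇒untouched w R (suc-injective (suc-injective (begin-equality
      suc (suc (deg R w))  ≡⟨ cong suc (deg-∷-incident R (Joins-incidentˡ jb)) ⟨
      suc (deg (b ∷ R) w)  ≡⟨ deg-∷-incident (b ∷ R) (Joins-incidentʳ ja) ⟨
      deg (a ∷ b ∷ R) w    ≡⟨ deg-↭ w E↭abR ⟨
      deg E w              ≡⟨ dw ⟩
      2                    ∎)))
    Tv↭bR : deleteVertex v E ↭ b ∷ R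
    Tv↭bR = ↭-trans (deleteVertex-↭ v E↭abR) (↭-reflexive
      (trans (deleteVertex-∷-incident (b ∷ R) (Joins-incidentˡ ja)) (deleteVertex-untouched v v∉bR)))
    Tw↭R : deleteVertex w (deleteVertex v E) ↭ R
    Tw↭R = ↭-trans (deleteVertex-↭ w Tv↭bR) (↭-reflexive
      (trans (deleteVertex-∷-incident R (Joins-incidentˡ jb)) (deleteVertex-untouched w w∉R)))

lemma8 : ∀ {n} (E : List (Edge n)) → IsTree E → (v w u : Fin n) →
    Adj E v w → Adj E w u → v ≢ u → deg E v ≡ 1 → deg E w ≡ 2 →
    efixCount E ≤ efixCount (deleteVertex v E) + efixCount (deleteVertex w (deleteVertex v E))
lemma8 E _ v w u vw wu v≢u dv dw
  with a , a∈E , ja ← Adj⇒Joins vw | b , b∈E , jb ← Adj⇒Joins wu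
  with R , E↭abR ← ∈∧∈⇒↭∷∷ a∈E b∈E (Joins-path-≢ v≢u ja jb)
  = efixCount-pendant-≤ E↭abR ja jb dv dw
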